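{- For every non-empty finite list $\bm{\pi}=[\pi_1,\dots,\pi_m]$ of elements of $\{0,1\}$ ($m\ge1$), the pair $(\|[\,],\bm{\pi}\|,\lambda n.4nm)$ is an actual event and $$\mathbb{P}(\|[\,],\bm{\pi}\|,\lambda n.4nm)=_{\mathbb{R}}\frac{\sum_{k=1}^{m}\pi_k}{m}.$$
   Context: A potential event is a sequence $\mathsf{e}:\mathbb{N}^{+}\to\{0,1\}$. $\|[\,],\bm{\pi}\|$ denotes the periodic potential event $i\mapsto\pi_{\mathsf{rm}(i-1,m)+1}$, where $\mathsf{rm}(a,b)$ is the remainder of $a$ divided by $b$. Define $\Phi(\mathsf{e})(n)=\frac{\sum_{i=1}^{n}\mathsf{e}(i)}{n}$. An actual event is a pair $(\mathsf{e},\gamma)$ with $\gamma:\mathbb{N}^{+}\to\mathbb{N}^{+}$ strictly increasing and $|\Phi(\mathsf{e})(\gamma(n)+i)-\Phi(\mathsf{e})(\gamma(n)+j)|\le\frac1n$ for all $n\in\mathbb{N}^{+}$, $i,j\in\mathbb{N}$; $\mathbb{P}(\mathsf{e},\gamma):=\Phi(\mathsf{e})\circ\gamma$. Bishop reals are sequences $x:\mathbb{N}^{+}\to\mathbb{Q}$ with $|x(n)-x(m)|\le\frac1n+\frac1m$; $x=_{\mathbb{R}}y$ iff $|x(n)-y(n)|\le\frac2n$ for all $n$; a rational is identified with the constant sequence. -}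

module Defs where

open import Data.Nat as ℕ using (ℕ; zero; suc; NonZero; _%_; _∸_)

open import Data.Bool using (Bool; true; false)
open import Data.List using (List; length; map)
open import Data.Nat.ListAction using (sum)
open import Data.Integer using (ℤ; +_)
open import Data.Rational using (ℚ; _/_; _-_; ∣_∣; _≤_; 0ℚ)
open import Data.Product using (_×_)

-- Positive integers ℕ⁺ are represented by natural numbers n together with
-- an instance (NonZero n). Sequences indexed by ℕ⁺ are functions on ℕ whose
-- value at 0 is irrelevant.

bit : Bool → ℕ
bit true  = 1
bit false = 0

PotentialEvent : Set
PotentialEvent = ℕ → Bool

-- i-th element (1-based) of a list, default false outside range
lookup1 : List Bool → ℕ → Bool
lookup1 Data.List.[] _ = false
lookup1 (b Data.List.∷ bs) zero = b   -- unused index 0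
lookup1 (b Data.List.∷ bs) (suc zero) = b
lookup1 (b Data.List.∷ bs) (suc (suc i)) = lookup1 bs (suc i)

rm : ℕ → (m : ℕ) → .{{NonZero m}} → ℕ
rm a m = a % m

-- ‖[], π‖ : i ↦ π_{rm(i-1,m)+1}, with m = length π (assumed ≥ 1)
periodic : (π : List Bool) → .{{NonZero (length π)}} → PotentialEvent
periodic π i = lookup1 π (suc (rm (i ∸ 1) (length π)))

countUpTo : PotentialEvent → ℕ → ℕ
countUpTo e zero = 0
countUpTo e (suc n) = countUpTo e n ℕ.+ bit (e (suc n))

Φ : PotentialEvent → (n : ℕ) → .{{NonZero n}} → ℚ
Φ e n = (+ countUpTo e n) / n

StrictlyIncreasing⁺ : (ℕ → ℕ) → Set
StrictlyIncreasing⁺ γ =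
  (∀ n → NonZero n → NonZero (γ n)) ×
  (∀ n m → NonZero n → n ℕ.< m → γ n ℕ.< γ m)

-- Φ(e)(γ(n)+i) with γ(n)+i ≥ 1 whenever γ(n) ≥ 1
Φ-at : PotentialEvent → (k : ℕ) → ℚ
Φ-at e zero = 0ℚ
Φ-at e (suc k) = Φ e (suc k)

IsActualEvent : PotentialEvent → (ℕ → ℕ) → Set
IsActualEvent e γ =
  StrictlyIncreasing⁺ γ ×
  (∀ (n : ℕ) .{{_ : NonZero n}} (i j : ℕ) →
     ∣ Φ-at e (γ n ℕ.+ i) - Φ-at e (γ n ℕ.+ j) ∣ ≤ (+ 1) / n)

ℙ : PotentialEvent → (ℕ → ℕ) → ℕ → ℚ
ℙ e γ n = Φ-at e (γ n)

-- Bishop real equality x =_ℝ y : |x(n) - y(n)| ≤ 2/n for all n ≥ 1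
_=ℝ_ : (ℕ → ℚ) → (ℕ → ℚ) → Set
x =ℝ y = ∀ (n : ℕ) .{{_ : NonZero n}} → ∣ x n - y n ∣ ≤ (+ 2) / n

const : ℚ → ℕ → ℚ
const q _ = q

bitSum : List Bool → ℕ
bitSum π = sum (map bit π)

module Submission where

-- Counting the ones of a sequence with period m, the first k terms consist of q = ⌊k/m⌋
-- full periods, each contributing the S = π₁ + … + πₘ ones of one period, plus a partial
-- period.  The full periods cancel in k·S/m, so the count differs from k·S/m by at most
-- m (i.e. |count·m − S·k| ≤ m²), and Φ(e)(k) is within m/k of S/m.  For k ≥ 4nm this is
-- at most 1/(4n), which gives the Cauchy condition with modulus 1/n through S/m by the
-- triangle inequality, and the Bishop equality ℙ =ℝ S/m with room to spare.

open import Defs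
open import Data.Nat using (ℕ; NonZero; _*_)
open import Data.Bool using (Bool)
open import Data.List using (List; length)
open import Data.Integer using (+_)
open import Data.Rational using (_/_)
open import Data.Product using (_×_)

open import Data.Bool using (true; false)
open import Data.Empty using (⊥-elim)
open import Data.Integer as ℤ using (_⊖_)
import Data.Integer.Properties as ℤP
open import Data.List using ([]; _∷_)
open import Data.Nat as ℕ using (zero; suc; _+_; _≤_; _<_; ∣_-_∣; _%_; z≤n; s≤s; ≢-nonZero⁻¹)
open import Data.Nat.DivMod using (m≡m%n+[m/n]*n; [m+n]%n≡m%n; m%n<n; m<n⇒m%n≡m)
open import Data.Nat.Properties
open import Data.Nat.Tactic.RingSolver using (solve-∀)
open import Data.Product using (_,_)
open import Data.Rational as ℚ using (ℚ; toℚᵘ)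
import Data.Rational.Properties as ℚP
open import Data.Rational.Solver using (module +-*-Solver)
open import Data.Rational.Unnormalised as ℚᵘ using (*≤*; *≡*)
import Data.Rational.Unnormalised.Properties as ℚᵘP
open import Function using (_∘_)
open import Relation.Binary.PropositionalEquality

Periodic : ℕ → PotentialEvent → Set
Periodic m e = ∀ i → e (suc i + m) ≡ e (suc i)

countUpTo-cong : ∀ {e e′} n → (∀ i → i < n → e (suc i) ≡ e′ (suc i)) →
                 countUpTo e n ≡ countUpTo e′ n
countUpTo-cong zero    eq = refl
countUpTo-cong (suc n) eq =
  cong₂ _+_ (countUpTo-cong n (λ i i<n → eq i (m<n⇒m<1+n i<n))) (cong bit (eq n ≤-refl))

countUpTo-≤ : ∀ e n → countUpTo e n ≤ n
countUpTo-≤ e zero    = z≤n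
countUpTo-≤ e (suc n) = subst (countUpTo e n + bit (e (suc n)) ≤_) (+-comm n 1)
  (+-mono-≤ (countUpTo-≤ e n) (bit≤1 (e (suc n))))
  where
  bit≤1 : ∀ b → bit b ≤ 1
  bit≤1 true  = s≤s z≤n
  bit≤1 false = z≤n

countUpTo-suc : ∀ e n → countUpTo e (suc n) ≡ bit (e 1) + countUpTo (e ∘ suc) n
countUpTo-suc e zero    = +-comm 0 (bit (e 1))
countUpTo-suc e (suc n) = begin
  countUpTo e (suc n) + bit (e (suc (suc n)))
    ≡⟨ cong (_+ bit (e (suc (suc n)))) (countUpTo-suc e n) ⟩
  bit (e 1) + countUpTo (e ∘ suc) n + bit (e (suc (suc n)))
    ≡⟨ +-assoc (bit (e 1)) _ _ ⟩
  bit (e 1) + countUpTo (e ∘ suc) (suc n) ∎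
  where open ≡-Reasoning

module _ {m : ℕ} {e : PotentialEvent} (per : Periodic m e) where

  countUpTo-+-period : ∀ k → countUpTo e (k + m) ≡ countUpTo e k + countUpTo e m
  countUpTo-+-period zero    = refl
  countUpTo-+-period (suc k) = begin
    countUpTo e (k + m) + bit (e (suc k + m))
      ≡⟨ cong₂ _+_ (countUpTo-+-period k) (cong bit (per k)) ⟩
    countUpTo e k + countUpTo e m + bit (e (suc k))
      ≡⟨ x+y+z≡x+z+y (countUpTo e k) _ _ ⟩
    countUpTo e (suc k) + countUpTo e m ∎
    where
    open ≡-Reasoning
    x+y+z≡x+z+y : ∀ x y z → x + y + z ≡ x + z + y
    x+y+z≡x+z+y = solve-∀

  countUpTo-+-periods : ∀ q r → countUpTo e (r + q * m) ≡ countUpTo e r + q * countUpTo e m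
  countUpTo-+-periods zero    r = trans (cong (countUpTo e) (+-identityʳ r)) (sym (+-identityʳ _))
  countUpTo-+-periods (suc q) r = begin
    countUpTo e (r + (m + q * m))        ≡⟨ cong (countUpTo e) (x+[y+z]≡x+z+y r m (q * m)) ⟩
    countUpTo e (r + q * m + m)          ≡⟨ countUpTo-+-period (r + q * m) ⟩
    countUpTo e (r + q * m) + S          ≡⟨ cong (_+ S) (countUpTo-+-periods q r) ⟩
    countUpTo e r + q * S + S            ≡⟨ x+y+z≡x+[z+y] (countUpTo e r) (q * S) S ⟩
    countUpTo e r + suc q * S            ∎
    where
    open ≡-Reasoning
    S = countUpTo e m
    x+[y+z]≡x+z+y : ∀ x y z → x + (y + z) ≡ x + z + y
    x+[y+z]≡x+z+y = solve-∀
    x+y+z≡x+[z+y] : ∀ x y z → x + y + z ≡ x + (z + y)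
    x+y+z≡x+[z+y] = solve-∀

  countUpTo-deviation : .{{_ : NonZero m}} → ∀ k →
                        ∣ countUpTo e k * m - countUpTo e m * k ∣ ≤ m * m
  countUpTo-deviation k = begin
    ∣ countUpTo e k * m - S * k ∣
      ≡⟨ cong₂ (λ x y → ∣ x - y ∣) count-side mean-side ⟩
    ∣ q * S * m + countUpTo e r * m - q * S * m + S * r ∣
      ≡⟨ ∣m+n-m+o∣≡∣n-o∣ (q * S * m) _ _ ⟩
    ∣ countUpTo e r * m - S * r ∣
      ≤⟨ ∣m-n∣≤m⊔n (countUpTo e r * m) (S * r) ⟩
    countUpTo e r * m ℕ.⊔ S * r
      ≤⟨ ⊔-lub (*-monoˡ-≤ m (≤-trans (countUpTo-≤ e r) r≤m))
               (*-mono-≤ (countUpTo-≤ e m) r≤m) ⟩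
    m * m ∎
    where
    open ≤-Reasoning
    S = countUpTo e m
    r = k % m
    q = k ℕ./ m
    r≤m : r ≤ m
    r≤m = <⇒≤ (m%n<n k m)
    k≡r+q*m : k ≡ r + q * m
    k≡r+q*m = m≡m%n+[m/n]*n k m
    [x+y*z]*w≡y*z*w+x*w : ∀ x y z w → (x + y * z) * w ≡ y * z * w + x * w
    [x+y*z]*w≡y*z*w+x*w = solve-∀
    x*[y+z*w]≡z*x*w+x*y : ∀ x y z w → x * (y + z * w) ≡ z * x * w + x * y
    x*[y+z*w]≡z*x*w+x*y = solve-∀
    count-side : countUpTo e k * m ≡ q * S * m + countUpTo e r * m
    count-side = begin-equality
      countUpTo e k * m               ≡⟨ cong (λ x → countUpTo e x * m) k≡r+q*m ⟩
      countUpTo e (r + q * m) * m     ≡⟨ cong (_* m) (countUpTo-+-periods q r) ⟩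
      (countUpTo e r + q * S) * m     ≡⟨ [x+y*z]*w≡y*z*w+x*w (countUpTo e r) q S m ⟩
      q * S * m + countUpTo e r * m   ∎
    mean-side : S * k ≡ q * S * m + S * r
    mean-side = trans (cong (S *_) k≡r+q*m) (x*[y+z*w]≡z*x*w+x*y S r q m)

∣m⊖n∣≡∣m-n∣ : ∀ m n → ℤ.∣ m ⊖ n ∣ ≡ ∣ m - n ∣
∣m⊖n∣≡∣m-n∣ zero    zero    = refl
∣m⊖n∣≡∣m-n∣ zero    (suc n) = refl
∣m⊖n∣≡∣m-n∣ (suc m) zero    = refl
∣m⊖n∣≡∣m-n∣ (suc m) (suc n) =
  trans (cong ℤ.∣_∣ (ℤP.[1+m]⊖[1+n]≡m⊖n m n)) (∣m⊖n∣≡∣m-n∣ m n)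

toℚᵘ-/ : ∀ i n .{{_ : NonZero n}} → toℚᵘ (i / n) ℚᵘ.≃ i ℚᵘ./ n
toℚᵘ-/ i (suc n) = ℚP.toℚᵘ-fromℚᵘ (i ℚᵘ./ suc n)

toℚᵘ-homo-∣p-q∣ : ∀ p q → toℚᵘ ℚ.∣ p ℚ.- q ∣ ℚᵘ.≃ ℚᵘ.∣ toℚᵘ p ℚᵘ.- toℚᵘ q ∣
toℚᵘ-homo-∣p-q∣ p q = ℚᵘP.≃-trans (ℚP.toℚᵘ-homo-∣-∣ (p ℚ.- q))
  (ℚᵘP.∣-∣-cong (ℚᵘP.≃-trans (ℚP.toℚᵘ-homo-+ p (ℚ.- q))
                              (ℚᵘP.+-cong (ℚᵘP.≃-refl {toℚᵘ p}) (ℚP.toℚᵘ-homo‿- q))))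

∣a/k-b/m∣≤p/d : ∀ a b k m p d .{{_ : NonZero k}} .{{_ : NonZero m}} .{{_ : NonZero d}} →
                ∣ a * m - b * k ∣ * d ≤ p * (k * m) →
                ℚ.∣ + a / k ℚ.- + b / m ∣ ℚ.≤ + p / d
∣a/k-b/m∣≤p/d a b k@(suc _) m@(suc _) p d@(suc _) h = ℚP.toℚᵘ-cancel-≤ (begin
  toℚᵘ ℚ.∣ + a / k ℚ.- + b / m ∣
    ≃⟨ toℚᵘ-homo-∣p-q∣ (+ a / k) (+ b / m) ⟩
  ℚᵘ.∣ toℚᵘ (+ a / k) ℚᵘ.- toℚᵘ (+ b / m) ∣
    ≃⟨ ℚᵘP.∣-∣-cong (ℚᵘP.+-cong (toℚᵘ-/ (+ a) k) (ℚᵘP.-‿cong (toℚᵘ-/ (+ b) m))) ⟩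
  ℚᵘ.∣ + a ℚᵘ./ k ℚᵘ.- + b ℚᵘ./ m ∣
    ≤⟨ *≤* cross-multiplied ⟩
  + p ℚᵘ./ d
    ≃⟨ toℚᵘ-/ (+ p) d ⟨
  toℚᵘ (+ p / d) ∎)
  where
  open ℚᵘP.≤-Reasoning
  numerator≡ : + a ℤ.* + m ℤ.+ ℤ.- + b ℤ.* + k ≡ a * m ⊖ b * k
  numerator≡ = trans
    (cong₂ ℤ._+_ (sym (ℤP.pos-* a m))
                 (trans (sym (ℤP.neg-distribˡ-* (+ b) (+ k))) (cong ℤ.-_ (sym (ℤP.pos-* b k)))))
    (ℤP.m-n≡m⊖n (a * m) (b * k))
  cross-multiplied : + ℤ.∣ + a ℤ.* + m ℤ.+ ℤ.- + b ℤ.* + k ∣ ℤ.* + d ℤ.≤ + p ℤ.* + (k * m)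
  cross-multiplied rewrite numerator≡ | ∣m⊖n∣≡∣m-n∣ (a * m) (b * k) =
    subst₂ ℤ._≤_ (ℤP.pos-* ∣ a * m - b * k ∣ d) (ℤP.pos-* p (k * m)) (ℤ.+≤+ h)

∣p-q∣≤∣p-r∣+∣q-r∣ : ∀ p q r → ℚ.∣ p ℚ.- q ∣ ℚ.≤ ℚ.∣ p ℚ.- r ∣ ℚ.+ ℚ.∣ q ℚ.- r ∣
∣p-q∣≤∣p-r∣+∣q-r∣ p q r =
  subst (λ x → ℚ.∣ x ∣ ℚ.≤ ℚ.∣ p ℚ.- r ∣ ℚ.+ ℚ.∣ q ℚ.- r ∣) (sym p-q≡[p-r]-[q-r])
        (ℚP.∣p-q∣≤∣p∣+∣q∣ (p ℚ.- r) (q ℚ.- r))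
  where
  open +-*-Solver
  p-q≡[p-r]-[q-r] : p ℚ.- q ≡ (p ℚ.- r) ℚ.- (q ℚ.- r)
  p-q≡[p-r]-[q-r] = solve 3 (λ p q r → p :- q := (p :- r) :- (q :- r)) refl p q r

p/[2d]+p/[2d]≡p/d : ∀ p d → + p / (2 * suc d) ℚ.+ + p / (2 * suc d) ≡ + p / suc d
p/[2d]+p/[2d]≡p/d p d = ℚP.toℚᵘ-injective halves-sum
  where
  s = suc d

  cross-multiplied : (+ p ℤ.* + (2 * s) ℤ.+ + p ℤ.* + (2 * s)) ℤ.* + s ≡ + p ℤ.* + (2 * s * (2 * s))
  cross-multiplied = begin
    (+ p ℤ.* + (2 * s) ℤ.+ + p ℤ.* + (2 * s)) ℤ.* + s
      ≡⟨ cong (ℤ._* + s) (cong₂ ℤ._+_ (ℤP.pos-* p (2 * s)) (ℤP.pos-* p (2 * s))) ⟨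
    (+ (p * (2 * s)) ℤ.+ + (p * (2 * s))) ℤ.* + s
      ≡⟨ cong (ℤ._* + s) (ℤP.pos-+ (p * (2 * s)) (p * (2 * s))) ⟨
    + (p * (2 * s) + p * (2 * s)) ℤ.* + s
      ≡⟨ ℤP.pos-* (p * (2 * s) + p * (2 * s)) s ⟨
    + ((p * (2 * s) + p * (2 * s)) * s)
      ≡⟨ cong +_ (ℕ-identity p s) ⟩
    + (p * (2 * s * (2 * s)))
      ≡⟨ ℤP.pos-* p (2 * s * (2 * s)) ⟩
    + p ℤ.* + (2 * s * (2 * s)) ∎
    where
    open ≡-Reasoning
    ℕ-identity : ∀ p s → (p * (2 * s) + p * (2 * s)) * s ≡ p * (2 * s * (2 * s))
    ℕ-identity = solve-∀

  halves-sum : toℚᵘ (+ p / (2 * s) ℚ.+ + p / (2 * s)) ℚᵘ.≃ toℚᵘ (+ p / s)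
  halves-sum = begin-equality
    toℚᵘ (+ p / (2 * s) ℚ.+ + p / (2 * s))
      ≃⟨ ℚP.toℚᵘ-homo-+ (+ p / (2 * s)) (+ p / (2 * s)) ⟩
    toℚᵘ (+ p / (2 * s)) ℚᵘ.+ toℚᵘ (+ p / (2 * s))
      ≃⟨ ℚᵘP.+-cong (toℚᵘ-/ (+ p) (2 * s)) (toℚᵘ-/ (+ p) (2 * s)) ⟩
    + p ℚᵘ./ (2 * s) ℚᵘ.+ + p ℚᵘ./ (2 * s)
      ≃⟨ *≡* cross-multiplied ⟩
    + p ℚᵘ./ s
      ≃⟨ toℚᵘ-/ (+ p) s ⟨
    toℚᵘ (+ p / s) ∎
    where open ℚᵘP.≤-Reasoning

scaled-strictlyIncreasing⁺ : ∀ a b .{{_ : NonZero a}} .{{_ : NonZero b}} →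
                             StrictlyIncreasing⁺ (λ n → a * n * b)
scaled-strictlyIncreasing⁺ a b =
  (λ n n≢0 → scaled-nonZero n {{n≢0}}) ,
  (λ n n′ _ n<n′ → *-monoˡ-< b (*-monoʳ-< a n<n′))
  where
  scaled-nonZero : ∀ n .{{_ : NonZero n}} → NonZero (a * n * b)
  scaled-nonZero n = m*n≢0 (a * n) b {{m*n≢0 a n}}

module _ {m : ℕ} {e : PotentialEvent} .{{_ : NonZero m}} (per : Periodic m e) where

  mean : ℚ
  mean = + countUpTo e m / m

  Φ-at-deviation : ∀ k p d .{{_ : NonZero d}} → d * m ≤ p * k →
                   ℚ.∣ Φ-at e k ℚ.- mean ∣ ℚ.≤ + p / d
  Φ-at-deviation zero p d d*m≤p*0 = ⊥-elim (≢-nonZero⁻¹ (d * m) {{m*n≢0 d m}}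
    (n≤0⇒n≡0 (subst (d * m ≤_) (*-zeroʳ p) d*m≤p*0)))
  Φ-at-deviation k@(suc _) p d d*m≤p*k =
    ∣a/k-b/m∣≤p/d (countUpTo e k) (countUpTo e m) k m p d (begin
      ∣ countUpTo e k * m - countUpTo e m * k ∣ * d ≤⟨ *-monoˡ-≤ d (countUpTo-deviation per k) ⟩
      m * m * d                                      ≡⟨ trans (*-assoc m m d) (cong (m *_) (*-comm m d)) ⟩
      m * (d * m)                                    ≤⟨ *-monoʳ-≤ m d*m≤p*k ⟩
      m * (p * k)                                    ≡⟨ x*[y*z]≡y*[z*x] m p k ⟩
      p * (k * m)                                    ∎)
    where
    open ≤-Reasoning
    x*[y*z]≡y*[z*x] : ∀ x y z → x * (y * z) ≡ y * (z * x)
    x*[y*z]≡y*[z*x] = solve-∀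

  Φ-at-cauchy : ∀ n k l .{{_ : NonZero n}} → 2 * n * m ≤ k → 2 * n * m ≤ l →
                ℚ.∣ Φ-at e k ℚ.- Φ-at e l ∣ ℚ.≤ + 1 / n
  Φ-at-cauchy (suc n) k l 2nm≤k 2nm≤l = begin
    ℚ.∣ Φ-at e k ℚ.- Φ-at e l ∣
      ≤⟨ ∣p-q∣≤∣p-r∣+∣q-r∣ (Φ-at e k) (Φ-at e l) mean ⟩
    ℚ.∣ Φ-at e k ℚ.- mean ∣ ℚ.+ ℚ.∣ Φ-at e l ℚ.- mean ∣
      ≤⟨ ℚP.+-mono-≤ (within-half k 2nm≤k) (within-half l 2nm≤l) ⟩
    + 1 / (2 * suc n) ℚ.+ + 1 / (2 * suc n)
      ≡⟨ p/[2d]+p/[2d]≡p/d 1 n ⟩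
    + 1 / suc n ∎
    where
    open ℚP.≤-Reasoning
    within-half : ∀ k → 2 * suc n * m ≤ k → ℚ.∣ Φ-at e k ℚ.- mean ∣ ℚ.≤ + 1 / (2 * suc n)
    within-half k 2nm≤k =
      Φ-at-deviation k 1 (2 * suc n) (subst (2 * suc n * m ≤_) (sym (*-identityˡ k)) 2nm≤k)

  periodic⇒isActualEvent : IsActualEvent e (λ n → 4 * n * m)
  periodic⇒isActualEvent = scaled-strictlyIncreasing⁺ 4 m ,
    λ n i j → Φ-at-cauchy n (4 * n * m + i) (4 * n * m + j) (2nm≤4nm+i n i) (2nm≤4nm+i n j)
    where
    2nm≤4nm+i : ∀ n i → 2 * n * m ≤ 4 * n * m + i
    2nm≤4nm+i n i = ≤-trans (*-monoˡ-≤ m (*-monoˡ-≤ n (s≤s (s≤s (z≤n {2}))))) (m≤m+n (4 * n * m) i)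

  periodic⇒ℙ=ℝmean : ℙ e (λ n → 4 * n * m) =ℝ const mean
  periodic⇒ℙ=ℝmean n = Φ-at-deviation (4 * n * m) 2 n
    (≤-trans (*-monoˡ-≤ m (m≤n*m n 4)) (m≤n*m (4 * n * m) 2))

countUpTo-lookup1 : ∀ π → countUpTo (lookup1 π) (length π) ≡ bitSum π
countUpTo-lookup1 []       = refl
countUpTo-lookup1 (b ∷ bs) = trans (countUpTo-suc (lookup1 (b ∷ bs)) (length bs))
  (cong (λ n → bit b + n) (trans (countUpTo-cong (length bs) (λ _ _ → refl)) (countUpTo-lookup1 bs)))

module _ (π : List Bool) .{{_ : NonZero (length π)}} where

  periodic-isPeriodic : Periodic (length π) (periodic π)
  periodic-isPeriodic i = cong (λ r → lookup1 π (suc r)) ([m+n]%n≡m%n i (length π))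

  countUpTo-periodic-length : countUpTo (periodic π) (length π) ≡ bitSum π
  countUpTo-periodic-length = trans
    (countUpTo-cong (length π) (λ i i<m → cong (λ r → lookup1 π (suc r)) (m<n⇒m%n≡m i<m)))
    (countUpTo-lookup1 π)

mainTheorem11 : (π : List Bool) .{{_ : NonZero (length π)}} →
    IsActualEvent (periodic π) (λ n → 4 * n * length π)
    × (ℙ (periodic π) (λ n → 4 * n * length π) =ℝ const ((+ bitSum π) / length π))
mainTheorem11 π =
  periodic⇒isActualEvent per ,
  subst (λ S → ℙ (periodic π) (λ n → 4 * n * length π) =ℝ const (+ S / length π))
        (countUpTo-periodic-length π) (periodic⇒ℙ=ℝmean per)
  where
  per : Periodic (length π) (periodic π)
  per = periodic-isPeriodic π
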